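{- Let $\mathcal{F}$ be a $\Delta$-filter on a semigroup $G$ and let $R \subseteq G^2$ be a binary relation such that $$\forall^\mathcal{F} h\ \forall^\mathcal{F} g\ R(g,gh),$$ i.e. the set of $h\in G$ for which $\{g \in G : R(g,gh)\}$ is $\mathcal{F}$-large is itself $\mathcal{F}$-large. Then for any $n \in \mathbb{N}$ there is a sequence $(g_i)_{i \le n}$ of elements of $G$ such that $R(g_j,g_i)$ holds for all $i<j\le n$. Moreover, if $A \subseteq G$ is an $n$-recurrent set (with respect to $\mathcal{F}$), the sequence $(g_i)_{i\le n}$ can be chosen inside $A$.
   Context: A filter $\mathcal{F}$ on a set $S$ is a nonempty family of subsets of $S$ not containing $\emptyset$, closed upward and under finite intersections. A set $A$ is $\mathcal{F}$-large if $A\in\mathcal{F}$, $\mathcal{F}$-small if $S\setminus A\in\mathcal{F}$, and $\mathcal{F}$-positive if it is not $\mathcal{F}$-small. "$\forall^\mathcal{F} x\, P(x)$" means the set of $x$ with $\neg P(x)$ is $\mathcal{F}$-small; "$\exists^\mathcal{F} x \in B\, P(x)$" means the set of $x\in B$ with $P(x)$ is $\mathcal{F}$-positive. Write $A \sim_\mathcal{F} B$ if $A\,\triangle\, B$ is $\mathcal{F}$-small, and $\tilde A \precsim_\mathcal{F} A$ if $\tilde A \sim_\mathcal{F} A$ and $\tilde A \subseteq A$. For a semigroup $G$, $A\subseteq G$, $g\in G$: $Ag^{ -1} := \{h \in G : hg \in A\}$ and $\partial_g A := A \cap Ag^{ -1}$. Recurrence with respect to $\mathcal{F}$: $A$ is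 $0$-recurrent if it is $\mathcal{F}$-positive; $\Delta^0(A)=A$; for $n\ge1$, $\Delta^n(A) := \{g \in G : \partial_g A \text{ is } (n-1)\text{ -recurrent}\}$, and $A$ is $n$-recurrent if $\Delta^n(A)$ is $\mathcal{F}$-positive. Write $\Delta(A)=\Delta^1(A)$. $\mathcal{F}$ respects recurrence if for all $n\ge1$ and $A \sim_\mathcal{F} \tilde A$, $A$ is $n$-recurrent iff $\tilde A$ is $n$-recurrent. $n$-thick in $\Delta(A)$: every $D$ is $0$-thick in $\Delta(A)$ for every $A$; for $n \ge 1$, $D$ is $n$-thick in $\Delta(A)$ if for every $n$-recurrent $\tilde A \precsim_\mathcal{F} A$, $\exists^\mathcal{F} g \in D$ such that $\partial_g \tilde A$ is $(n-1)$-recurrent and $\partial_g D$ is $(n-1)$-thick in $\Delta(\partial_g \tilde A)$. A $\Delta$-filter is a filter $\mathcal{F}$ on $G$ that respects recurrence and such that every $\mathcal{F}$-large $H$ is $n$-thick in $\Delta(A)$ for every $A \subseteq G$ and $n\ge 0$. -}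

module Defs where

open import Level using (Level; _⊔_) renaming (suc to lsuc; zero to 0ℓ)
open import Data.Nat using (ℕ; zero; suc)
open import Data.Product using (Σ; _×_; _,_)
open import Data.Sum using (_⊎_)
open import Data.Unit.Polymorphic using (⊤)
open import Data.Empty using (⊥)
open import Relation.Nullary using (¬_)

module _ {G : Set} (_∙_ : G → G → G) (F : (G → Set) → Set) where

  record IsFilter : Set₁ where
    field
      nonempty    : Σ (G → Set) F
      no-empty    : ¬ F (λ _ → ⊥)
      upward      : ∀ (A B : G → Set) → (∀ g → A g → B g) → F A → F B
      intersect   : ∀ (A B : G → Set) → F A → F B → F (λ g → A g × B g)

  -- P is F-small iff its complement is F-large.  For predicates of
  -- arbitrary universe level this is written out as: the complement
  -- contains an F-large set (equivalent, by upward closure, to the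
  -- complement itself being F-large when P : G → Set).
  Small : ∀ {ℓ} → (G → Set ℓ) → Set (lsuc 0ℓ ⊔ ℓ)
  Small P = Σ (G → Set) λ B → F B × (∀ g → B g → ¬ P g)

  Positive : ∀ {ℓ} → (G → Set ℓ) → Set (lsuc 0ℓ ⊔ ℓ)
  Positive P = ¬ Small P

  _·⁻¹_ : (G → Set) → G → (G → Set)
  (A ·⁻¹ g) h = A (h ∙ g)

  ∂ : G → (G → Set) → (G → Set)
  ∂ g A h = A h × (A ·⁻¹ g) h

  -- n-recurrence: A is n-recurrent iff Δⁿ(A) is F-positive, where
  -- Δ⁰(A) = A and Δⁿ⁺¹(A) = {g | ∂_g A is n-recurrent}.
  Recurrent : ℕ → (G → Set) → Set₁
  Recurrent zero A = Positive A
  Recurrent (suc n) A = Positive (λ g → Recurrent n (∂ g A))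

  ΔS : ℕ → (G → Set) → (G → Set₁)
  ΔS n A g = Recurrent n (∂ g A)

  _∼_ : (G → Set) → (G → Set) → Set₁
  A ∼ B = Small (λ g → (A g × ¬ B g) ⊎ (B g × ¬ A g))

  _≾_ : (G → Set) → (G → Set) → Set₁
  Ã ≾ A = (Ã ∼ A) × (∀ g → Ã g → A g)

  RespectsRecurrence : Set₁
  RespectsRecurrence = ∀ (n : ℕ) (A Ã : G → Set) → A ∼ Ã →
    (Recurrent (suc n) A → Recurrent (suc n) Ã) × (Recurrent (suc n) Ã → Recurrent (suc n) A)

  Thick : ℕ → (G → Set) → (G → Set) → Set₁
  Thick zero D A = ⊤
  Thick (suc n) D A = ∀ (Ã : G → Set) → Ã ≾ A → Recurrent (suc n) Ã →
    Positive (λ g → D g × Recurrent n (∂ g Ã) × Thick n (∂ g D) (∂ g Ã))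

  record IsΔFilter : Set₁ where
    field
      isFilter   : IsFilter
      respects   : RespectsRecurrence
      largeThick : ∀ (H : G → Set) → F H → ∀ (A : G → Set) (n : ℕ) → Thick n H A

module Submission where

-- Call a sequence g₀, …, gₙ an R-chain in A if every gᵢ
-- lies in A and R(gⱼ, gᵢ) holds for all i < j.  Call h ∈ D a good step
-- when ∀^F g R(g, gh).  The heart of the argument is an induction on n:
--
--   if A is n-recurrent, D is n-thick in Δ(A) and every h ∈ D is a good
--   step, then A contains an R-chain of length n + 1.
--
-- For n = 0 a positive set is nonempty.  For n + 1, thickness of D yields
-- h ∈ D with ∂_h A n-recurrent and ∂_h D n-thick in Δ(∂_h A).  Shrinking
-- ∂_h A by the F-large set {g | R(g, gh)} keeps both properties, because
-- the filter respects recurrence.  Applying the induction hypothesis to the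
-- relation R'(x, y) := R(x, y) ∧ R(x, yh) (whose good steps include ∂_h D,
-- by associativity) gives a chain g₀, …, gₙ, and g₀h, g₀, …, gₙ is the
-- required R-chain.  The theorem is the case D = the set of good steps,
-- which is F-large hence thick; the unconstrained version takes A = G.

open import Defs
open import Level using (Level)
open import Axiom.ExcludedMiddle using (ExcludedMiddle)
open import Data.Nat using (ℕ; suc; zero; z≤n; s≤s)
open import Data.Fin using (Fin; _<_)
open import Data.Product using (Σ; _×_; _,_; proj₁; proj₂)
open import Data.Sum using (inj₁; inj₂)
open import Data.Empty using (⊥; ⊥-elim)
open import Data.Unit using (⊤; tt)
import Data.Unit.Polymorphic as Poly
open import Relation.Nullary using (yes; no)
open import Relation.Binary.PropositionalEquality using (_≡_; subst; sym)
open import Algebra.Structures using (IsSemigroup)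

module ChainConstruction (em : ∀ {ℓ : Level} → ExcludedMiddle ℓ)
  (G : Set) (_∙_ : G → G → G) (isSemigroup : IsSemigroup _≡_ _∙_)
  (F : (G → Set) → Set) (isΔFilter : IsΔFilter _∙_ F) where

  open IsΔFilter isΔFilter
  open IsFilter isFilter
  open IsSemigroup isSemigroup using (assoc)

  Chain : (R : G → G → Set) (A : G → Set) (n : ℕ) → Set
  Chain R A n = Σ (Fin (suc n) → G) λ gs →
    (∀ i → A (gs i)) × (∀ (i j : Fin (suc n)) → i < j → R (gs j) (gs i))

  GoodSteps : (R : G → G → Set) (D : G → Set) → Set
  GoodSteps R D = ∀ h → D h → F (λ g → R g (g ∙ h))

  -- A positive set has an element (classically: were it empty, it would be
  -- small, as the complement of any F-large set).
  positive⇒inhabited : ∀ {ℓ} (P : G → Set ℓ) → Positive _∙_ F P → Σ G P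
  positive⇒inhabited P pos with em {P = Σ G P}
  ... | yes witness = witness
  ... | no empty    = ⊥-elim (pos (proj₁ nonempty , proj₂ nonempty ,
                                   λ g _ p → empty (g , p)))

  universal-recurrent : ∀ n (A : G → Set) → (∀ g → A g) → Recurrent _∙_ F n A
  universal-recurrent zero A full (B , FB , B∩A-empty) =
    no-empty (upward B (λ _ → ⊥) (λ g b → B∩A-empty g b (full g)) FB)
  universal-recurrent (suc n) A full (B , FB , B∩ΔA-empty) =
    no-empty (upward B (λ _ → ⊥)
      (λ g b → B∩ΔA-empty g b
        (universal-recurrent n (∂ _∙_ F g A) (λ h → full h , full (h ∙ g)))) FB)

  ∩-large-≾ : ∀ (A B : G → Set) → F B → _≾_ _∙_ F (λ g → A g × B g) A
  ∩-large-≾ A B FB =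
    (B , FB , λ { g _ (inj₁ ((a , _) , ¬a)) → ¬a a
                ; g b (inj₂ (a , ¬ab))     → ¬ab (a , b) }) ,
    λ g ab → proj₁ ab

  ≾-refl : ∀ A → _≾_ _∙_ F A A
  ≾-refl A = (proj₁ nonempty , proj₂ nonempty ,
    λ { g _ (inj₁ (a , ¬a)) → ¬a a ; g _ (inj₂ (a , ¬a)) → ¬a a }) , λ g a → a

  ≾-trans : ∀ Ã A′ A → _≾_ _∙_ F Ã A′ → _≾_ _∙_ F A′ A → _≾_ _∙_ F Ã A
  ≾-trans Ã A′ A ((B₁ , FB₁ , small₁) , Ã⊆A′) ((B₂ , FB₂ , small₂) , A′⊆A) =
    ((λ g → B₁ g × B₂ g) , intersect B₁ B₂ FB₁ FB₂ ,
      λ { g _ (inj₁ (ã , ¬a)) → ¬a (A′⊆A g (Ã⊆A′ g ã))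
        ; g (b₁ , b₂) (inj₂ (a , ¬ã)) →
            small₂ g b₂ (inj₂ (a , λ a′ → small₁ g b₁ (inj₂ (a′ , ¬ã)))) }) ,
    λ g ã → A′⊆A g (Ã⊆A′ g ã)

  -- Thickness in Δ(A) passes to every Ã ≾ A, since it quantifies over them.
  thick-≾ : ∀ n D Ã A → _≾_ _∙_ F Ã A → Thick _∙_ F n D A → Thick _∙_ F n D Ã
  thick-≾ zero    D Ã A _    _     = Poly.tt
  thick-≾ (suc n) D Ã A Ã≾A thick A″ A″≾Ã = thick A″ (≾-trans A″ Ã A A″≾Ã Ã≾A)

  -- Positivity, and hence (filter respects recurrence) n-recurrence,
  -- passes to F-equivalent subsets.
  positive-≾ : ∀ Ã A → _≾_ _∙_ F Ã A → Positive _∙_ F A → Positive _∙_ F Ã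
  positive-≾ Ã A ((C , FC , smallΔ) , _) pos (B , FB , B∩Ã-empty) =
    pos ((λ g → B g × C g) , intersect B C FB FC ,
      λ g (b , c) a → smallΔ g c (inj₂ (a , B∩Ã-empty g b)))

  recurrent-≾ : ∀ n Ã A → _≾_ _∙_ F Ã A → Recurrent _∙_ F n A → Recurrent _∙_ F n Ã
  recurrent-≾ zero    Ã A Ã≾A = positive-≾ Ã A Ã≾A
  recurrent-≾ (suc n) Ã A Ã≾A = proj₂ (respects n Ã A (proj₁ Ã≾A))

  Shifted : (R : G → G → Set) (h : G) → G → G → Set
  Shifted R h x y = R x y × R x (y ∙ h)

  -- If D consists of good steps for R, then ∂_h D consists of good steps
  -- for the shifted relation (uses g(kh) = (gk)h).
  shifted-good-steps : ∀ R D h → GoodSteps R D → GoodSteps (Shifted R h) (∂ _∙_ F h D)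
  shifted-good-steps R D h good k (k∈D , kh∈D) =
    intersect _ _ (good k k∈D)
      (upward _ _ (λ g r → subst (R g) (sym (assoc g k h)) r) (good (k ∙ h) kh∈D))

  -- A shifted chain g₀, …, gₙ in {g ∈ ∂_h A | R(g, gh)} extends to the
  -- R-chain g₀h, g₀, …, gₙ in A.
  prepend : ∀ {n} R h A →
    Chain (Shifted R h) (λ g → ∂ _∙_ F h A g × R g (g ∙ h)) n → Chain R A (suc n)
  prepend R h A (gs , inside , related) = gs⁺ , inside⁺ , related⁺
    where
    gs⁺ : Fin _ → G
    gs⁺ Fin.zero    = gs Fin.zero ∙ h
    gs⁺ (Fin.suc i) = gs i

    inside⁺ : ∀ i → A (gs⁺ i)
    inside⁺ Fin.zero    = proj₂ (proj₁ (inside Fin.zero))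
    inside⁺ (Fin.suc i) = proj₁ (proj₁ (inside i))

    related⁺ : ∀ i j → i < j → R (gs⁺ j) (gs⁺ i)
    related⁺ Fin.zero    (Fin.suc Fin.zero)    _       = proj₂ (inside Fin.zero)
    related⁺ Fin.zero    (Fin.suc (Fin.suc j)) _       =
      proj₂ (related Fin.zero (Fin.suc j) (s≤s z≤n))
    related⁺ (Fin.suc i) (Fin.suc j)           (s≤s p) = proj₁ (related i j p)

  chain-in-recurrent : ∀ n R (A D : G → Set) → Recurrent _∙_ F n A →
    Thick _∙_ F n D A → GoodSteps R D → Chain R A n
  chain-in-recurrent zero R A D recurrent _ _ =
    let (g , g∈A) = positive⇒inhabited A recurrent
    in (λ _ → g) , (λ _ → g∈A) , λ { Fin.zero Fin.zero () }
  chain-in-recurrent (suc n) R A D recurrent thick good =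
    prepend R h A (chain-in-recurrent n (Shifted R h) A′ (∂ _∙_ F h D)
      (recurrent-≾ n A′ (∂ _∙_ F h A) A′≾∂A ∂A-recurrent)
      (thick-≾ n (∂ _∙_ F h D) A′ (∂ _∙_ F h A) A′≾∂A ∂D-thick)
      (shifted-good-steps R D h good))
    where
    step : Σ G λ g → D g × Recurrent _∙_ F n (∂ _∙_ F g A)
                         × Thick _∙_ F n (∂ _∙_ F g D) (∂ _∙_ F g A)
    step = positive⇒inhabited _ (thick A (≾-refl A) recurrent)

    h : G
    h = proj₁ step

    h∈D : D h
    h∈D = proj₁ (proj₂ step)

    ∂A-recurrent : Recurrent _∙_ F n (∂ _∙_ F h A)
    ∂A-recurrent = proj₁ (proj₂ (proj₂ step))

    ∂D-thick : Thick _∙_ F n (∂ _∙_ F h D) (∂ _∙_ F h A)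
    ∂D-thick = proj₂ (proj₂ (proj₂ step))

    A′ : G → Set
    A′ g = ∂ _∙_ F h A g × R g (g ∙ h)

    A′≾∂A : _≾_ _∙_ F A′ (∂ _∙_ F h A)
    A′≾∂A = ∩-large-≾ (∂ _∙_ F h A) (λ g → R g (g ∙ h)) (good h h∈D)

-- The set of good steps is F-large, hence n-thick in Δ(A) for every A; so
-- every n-recurrent A contains an R-chain, and G itself is n-recurrent.
mainTheorem1 : (∀ {ℓ : Level} → ExcludedMiddle ℓ) →
    (G : Set) (_∙_ : G → G → G) → IsSemigroup _≡_ _∙_ →
    (F : (G → Set) → Set) → IsΔFilter _∙_ F →
    (R : G → G → Set) → F (λ h → F (λ g → R g (g ∙ h))) →
    (n : ℕ) →
      (Σ (Fin (suc n) → G) λ gs → ∀ (i j : Fin (suc n)) → i < j → R (gs j) (gs i))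
      × (∀ (A : G → Set) → Recurrent _∙_ F n A →
           Σ (Fin (suc n) → G) λ gs → (∀ i → A (gs i))
             × (∀ (i j : Fin (suc n)) → i < j → R (gs j) (gs i)))
mainTheorem1 em G _∙_ isSemigroup F isΔFilter R goodStepsLarge n =
  unconstrained , chainIn
  where
  open ChainConstruction em G _∙_ isSemigroup F isΔFilter
  open IsΔFilter isΔFilter using (largeThick)

  goodSteps : G → Set
  goodSteps h = F (λ g → R g (g ∙ h))

  chainIn : ∀ A → Recurrent _∙_ F n A → Chain R A n
  chainIn A recurrent = chain-in-recurrent n R A goodSteps recurrent
    (largeThick goodSteps goodStepsLarge A n) (λ h good → good)

  unconstrained : Σ (Fin (suc n) → G) λ gs → ∀ (i j : Fin (suc n)) → i < j → R (gs j) (gs i)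
  unconstrained =
    let (gs , _ , related) = chainIn (λ _ → ⊤) (universal-recurrent n _ (λ _ → tt))
    in gs , related
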